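{- Let $a,b\ge1$ and $P=[a]\times[b]$ with the product order. Let $x_1,\dots,x_{ab}$ be any enumeration of the elements $(k,\ell)$ of $P$ in weakly increasing order of $\ell-k$, and define promotion $\partial_J:J(P)\to J(P)$ by $\partial_J=\sigma_{x_{ab}}\circ\sigma_{x_{ab-1}}\circ\cdots\circ\sigma_{x_1}$. Then the cardinality statistic $I\mapsto\#I$ is $c$-mesic under $\partial_J$ with $c=ab/2$: for every $\partial_J$-orbit $\mathcal{O}\subseteq J(P)$, $\frac{1}{\#\mathcal{O}}\sum_{I\in\mathcal{O}}\#I=\frac{ab}{2}$.
   Context: $[n]$ denotes the chain $1<2<\dots<n$; in $[a]\times[b]$, $(k,\ell)\le(k',\ell')$ iff $k\le k'$ and $\ell\le\ell'$. $J(P)$ is the set of order ideals (down-closed subsets) of $P$. For $x\in P$, the toggle $\sigma_x:J(P)\to J(P)$ sends $I$ to $I\triangle\{x\}$ if this is an order ideal, and to $I$ otherwise. Toggles at elements with the same value of $\ell-k$ commute, so $\partial_J$ does not depend on the chosen enumeration; $\partial_J$ is invertible of finite order. $c$-mesic means the average over every orbit equals $c$. -}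

module Defs where

open import Data.Nat using (ℕ; zero; suc; _+_)
open import Data.Bool using (Bool; true; false; not; if_then_else_)
open import Data.Bool.Properties using () renaming (_≟_ to _≟ᵇ_)
open import Data.Fin using (Fin; toℕ; _≤_; _≟_)
open import Data.Fin.Properties using (all?) renaming (_≤?_ to _≤ᶠ?_)
open import Data.Integer using (ℤ; +_; _-_) renaming (_≤_ to _≤ℤ_)
open import Data.List using (List; foldl; concatMap; map)
open import Data.List.Relation.Unary.Linked using (Linked)
open import Data.List.Relation.Binary.Permutation.Propositional using (_↭_)
open import Data.Product using (_×_; _,_)
open import Data.Vec using (Vec; []; _∷_; lookup; updateAt; toList; allFin)
open import Relation.Binary.PropositionalEquality using (_≡_)
open import Relation.Nullary using (Dec; does; ¬_)
import Data.Nat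
open import Relation.Nullary.Decidable using (_→-dec_; _×-dec_)

-- The poset P = [a] × [b]; element (k , ℓ) with k : Fin a, ℓ : Fin b
-- (0-based indices; the order is unaffected by the shift).
Elt : ℕ → ℕ → Set
Elt a b = Fin a × Fin b

_≼_ : ∀ {a b} → Elt a b → Elt a b → Set
(k , ℓ) ≼ (k′ , ℓ′) = (k ≤ k′) × (ℓ ≤ ℓ′)

Subset : ℕ → ℕ → Set
Subset a b = Vec (Vec Bool b) a

_∈P_ : ∀ {a b} → Elt a b → Subset a b → Set
(k , ℓ) ∈P I = lookup (lookup I k) ℓ ≡ true

IsIdeal : ∀ {a b} → Subset a b → Set
IsIdeal {a} {b} I =
  (k k′ : Fin a) (ℓ ℓ′ : Fin b) → (k′ , ℓ′) ≼ (k , ℓ) → (k , ℓ) ∈P I → (k′ , ℓ′) ∈P I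

isIdeal? : ∀ {a b} (I : Subset a b) → Dec (IsIdeal I)
isIdeal? I =
  all? λ k → all? λ k′ → all? λ ℓ → all? λ ℓ′ →
    ((k′ ≤ᶠ? k) ×-dec (ℓ′ ≤ᶠ? ℓ))
    →-dec ((lookup (lookup I k) ℓ ≟ᵇ true)
    →-dec (lookup (lookup I k′) ℓ′ ≟ᵇ true))

flipAt : ∀ {a b} → Elt a b → Subset a b → Subset a b
flipAt (k , ℓ) I = updateAt I k (λ row → updateAt row ℓ not)

toggle : ∀ {a b} → Elt a b → Subset a b → Subset a b
toggle x I = if does (isIdeal? (flipAt x I)) then flipAt x I else I

diag : ∀ {a b} → Elt a b → ℤ
diag (k , ℓ) = + toℕ ℓ - + toℕ k

allElts : (a b : ℕ) → List (Elt a b)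
allElts a b = concatMap (λ k → map (λ ℓ → (k , ℓ)) (toList (allFin b))) (toList (allFin a))

IsDiagEnumeration : ∀ {a b} → List (Elt a b) → Set
IsDiagEnumeration {a} {b} e =
  (e ↭ allElts a b) × Linked (λ x y → diag x ≤ℤ diag y) e

-- ∂_J = σ_{x_ab} ∘ ⋯ ∘ σ_{x₁}  (x₁ is applied first)
promotion : ∀ {a b} → List (Elt a b) → Subset a b → Subset a b
promotion e I = foldl (λ J x → toggle x J) I e

iter : ∀ {A : Set} → (A → A) → ℕ → A → A
iter f zero x = x
iter f (suc n) x = f (iter f n x)

countRow : ∀ {n} → Vec Bool n → ℕ
countRow [] = 0
countRow (true ∷ r) = suc (countRow r)
countRow (false ∷ r) = countRow r

card : ∀ {a b} → Subset a b → ℕ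
card [] = 0
card (row ∷ I) = countRow row + card I

sumUpTo : ℕ → (ℕ → ℕ) → ℕ
sumUpTo zero f = 0
sumUpTo (suc n) f = sumUpTo n f + f n

IsOrbitSize : ∀ {A : Set} → (A → A) → A → ℕ → Set
IsOrbitSize f x n =
  (1 Data.Nat.≤ n) × (iter f n x ≡ x) ×
  ((m : ℕ) → 1 Data.Nat.≤ m → m Data.Nat.< n → ¬ (iter f m x ≡ x))

module Submission where

-- A toggle only changes its own
-- element, and its effect is read off from the four covers of the element.
-- Sweeping P in weakly increasing order of ℓ − k, the element x = (k,ℓ) is
-- toggled after its covers (k+1,ℓ), (k,ℓ−1) and before (k−1,ℓ), (k,ℓ+1); an
-- induction along the sweep then gives promotion in closed form: if the
-- corner (a−1,0) lies in I, ∂I is I shifted by one in ℓ (the column ℓ = 0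
-- leaves); otherwise ∂I is I shifted by one in k (a full row enters at k = 0).
-- For both shifts, with R = Σ_{(k,ℓ)∈I} k and L = Σ_{(k,ℓ)∈I} ℓ, the
-- potentials Φ = 2R + b·#I and Ψ = 2L + (a+1)·#I (kPotential, ℓPotential)
-- satisfy
--   Φ(∂I) + ab + Ψ(I) = Φ(I) + 2·#I + Ψ(∂I),
-- and summing this over an orbit telescopes to n·ab = 2·Σ #I.

open import Defs
open import Data.Nat using (ℕ; zero; suc; _+_; _*_; _≤_; _<_; z≤n; s≤s; _≟_; _<?_)
open import Data.Nat.Properties
  using ( ≤-refl; ≤-trans; ≤-pred; ≤-<-trans; ≤∧≢⇒<; n≤1+n; 1+n≢n; <⇒≱; +-monoʳ-<; +-comm
        ; +-cancelʳ-≡; +-cancelˡ-≡; *-distribˡ-+; *-zeroʳ)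
open import Data.Nat.Tactic.RingSolver using (solve-∀)
open import Data.Bool using (Bool; true; false; not; if_then_else_; _∧_; _∨_)
open import Data.Bool.Properties using (¬-not; ∧-zeroʳ; ∧-identityʳ)
open import Data.Fin as F using (Fin; toℕ; fromℕ<)
import Data.Fin.Properties as FP
open import Data.Vec as V using (Vec; []; _∷_; lookup; updateAt; _∷ʳ_; toList)
open import Data.List as L using (List; []; _∷_; _++_; [_]; foldl; map; concatMap; cartesianProduct)
open import Data.List.Properties using (++-assoc; ++-identityʳ)
open import Data.List.Membership.Propositional using (_∈_; _∉_)
open import Data.List.Membership.Propositional.Properties
  using (∈-++⁻; ∈-++⁺ˡ; ∈-++⁺ʳ; ∈-cartesianProduct⁺; ∈-allFin)
open import Data.List.Relation.Unary.Any using (here; there)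
import Data.List.Relation.Unary.All as All
open import Data.List.Relation.Unary.AllPairs as AllPairs using (AllPairs; []; _∷_)
open import Data.List.Relation.Unary.Unique.Propositional using (Unique)
import Data.List.Relation.Unary.Unique.Propositional.Properties as Uniqueₚ
open import Data.List.Relation.Unary.Linked.Properties using (Linked⇒AllPairs)
open import Data.List.Relation.Binary.Permutation.Propositional using (↭-sym; ↭⇒↭ₛ)
open import Data.List.Relation.Binary.Permutation.Propositional.Properties using (∈-resp-↭)
import Data.List.Relation.Binary.Permutation.Setoid.Properties as PermSetoid
open import Data.Integer as ℤ using (ℤ; _-_) renaming (_≤_ to _≤ℤ_)
import Data.Integer.Properties as ℤₚ
open import Data.Integer.Tactic.RingSolver using () renaming (solve-∀ to solveℤ-∀)
open import Data.Product using (_×_; _,_; proj₁; proj₂)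
open import Data.Product.Properties using (≡-dec)
open import Data.Sum using (_⊎_; inj₁; inj₂)
open import Function using (_∘_)
open import Relation.Nullary using (¬_; Dec; yes; no; does; contradiction)
open import Relation.Nullary.Decidable using (_×-dec_)
open import Relation.Binary.PropositionalEquality
  using (_≡_; _≢_; refl; sym; trans; cong; cong₂; subst; subst₂)
open import Relation.Binary.PropositionalEquality.Properties using (setoid)
open Relation.Binary.PropositionalEquality.≡-Reasoning

-- Membership with natural-number coordinates.  Positions outside the array
-- count as absent, so the neighbours (k+1,ℓ), (k,ℓ+1) of any element can be
-- queried without bound proofs.
rowAt : ∀ {n} → Vec Bool n → ℕ → Bool
rowAt []      _       = false
rowAt (x ∷ r) zero    = x
rowAt (x ∷ r) (suc i) = rowAt r i

memAt : ∀ {a b} → Subset a b → ℕ → ℕ → Bool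
memAt []      k       ℓ = false
memAt (r ∷ I) zero    ℓ = rowAt r ℓ
memAt (r ∷ I) (suc k) ℓ = memAt I k ℓ

lookup-rowAt : ∀ {n} (r : Vec Bool n) (i : Fin n) → lookup r i ≡ rowAt r (toℕ i)
lookup-rowAt (x ∷ r) F.zero    = refl
lookup-rowAt (x ∷ r) (F.suc i) = lookup-rowAt r i

rowAt-lookup : ∀ {a b} (I : Subset a b) (k : Fin a) ℓ → rowAt (lookup I k) ℓ ≡ memAt I (toℕ k) ℓ
rowAt-lookup (r ∷ I) F.zero    ℓ = refl
rowAt-lookup (r ∷ I) (F.suc k) ℓ = rowAt-lookup I k ℓ

lookup-memAt : ∀ {a b} (I : Subset a b) (k : Fin a) (ℓ : Fin b) →
  lookup (lookup I k) ℓ ≡ memAt I (toℕ k) (toℕ ℓ)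
lookup-memAt I k ℓ = trans (lookup-rowAt (lookup I k) ℓ) (rowAt-lookup I k (toℕ ℓ))

lookup-fromℕ< : ∀ {a b} (I : Subset a b) {k ℓ} (k<a : k < a) (ℓ<b : ℓ < b) →
  lookup (lookup I (fromℕ< k<a)) (fromℕ< ℓ<b) ≡ memAt I k ℓ
lookup-fromℕ< I k<a ℓ<b = trans (lookup-memAt I (fromℕ< k<a) (fromℕ< ℓ<b))
  (cong₂ (memAt I) (FP.toℕ-fromℕ< k<a) (FP.toℕ-fromℕ< ℓ<b))

rowAt-bound : ∀ {n} (r : Vec Bool n) i → rowAt r i ≡ true → i < n
rowAt-bound (x ∷ r) zero    _ = s≤s z≤n
rowAt-bound (x ∷ r) (suc i) h = s≤s (rowAt-bound r i h)

memAt-bound : ∀ {a b} (I : Subset a b) k ℓ → memAt I k ℓ ≡ true → k < a × ℓ < b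
memAt-bound (r ∷ I) zero    ℓ h = s≤s z≤n , rowAt-bound r ℓ h
memAt-bound (r ∷ I) (suc k) ℓ h with memAt-bound I k ℓ h
... | k<a , ℓ<b = s≤s k<a , ℓ<b

memAt-beyond : ∀ {a b} (I : Subset a b) k ℓ → ¬ ℓ < b → memAt I k ℓ ≡ false
memAt-beyond I k ℓ ℓ≮b = ¬-not λ x∈ → ℓ≮b (proj₂ (memAt-bound I k ℓ x∈))

vec-ext : ∀ {A : Set} {n} (u v : Vec A n) → (∀ i → lookup u i ≡ lookup v i) → u ≡ v
vec-ext []      []      h = refl
vec-ext (x ∷ u) (y ∷ v) h = cong₂ _∷_ (h F.zero) (vec-ext u v (λ i → h (F.suc i)))

subset-ext : ∀ {a b} (I J : Subset a b) →
  (∀ (k : Fin a) (ℓ : Fin b) → memAt I (toℕ k) (toℕ ℓ) ≡ memAt J (toℕ k) (toℕ ℓ)) → I ≡ J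
subset-ext I J h = vec-ext I J λ k → vec-ext (lookup I k) (lookup J k) λ ℓ →
  trans (lookup-memAt I k ℓ) (trans (h k ℓ) (sym (lookup-memAt J k ℓ)))

rowAt-updateAt-same : ∀ {n} (r : Vec Bool n) (j : Fin n) f →
  rowAt (updateAt r j f) (toℕ j) ≡ f (rowAt r (toℕ j))
rowAt-updateAt-same (x ∷ r) F.zero    f = refl
rowAt-updateAt-same (x ∷ r) (F.suc j) f = rowAt-updateAt-same r j f

rowAt-updateAt-other : ∀ {n} (r : Vec Bool n) (j : Fin n) f i → i ≢ toℕ j →
  rowAt (updateAt r j f) i ≡ rowAt r i
rowAt-updateAt-other (x ∷ r) F.zero    f zero    i≢j = contradiction refl i≢j
rowAt-updateAt-other (x ∷ r) F.zero    f (suc i) i≢j = refl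
rowAt-updateAt-other (x ∷ r) (F.suc j) f zero    i≢j = refl
rowAt-updateAt-other (x ∷ r) (F.suc j) f (suc i) i≢j =
  rowAt-updateAt-other r j f i (λ e → i≢j (cong suc e))

memAt-updateAt-same : ∀ {a b} (I : Subset a b) (k : Fin a) g ℓ →
  memAt (updateAt I k g) (toℕ k) ℓ ≡ rowAt (g (lookup I k)) ℓ
memAt-updateAt-same (r ∷ I) F.zero    g ℓ = refl
memAt-updateAt-same (r ∷ I) (F.suc k) g ℓ = memAt-updateAt-same I k g ℓ

memAt-updateAt-other : ∀ {a b} (I : Subset a b) (k : Fin a) g k′ ℓ → k′ ≢ toℕ k →
  memAt (updateAt I k g) k′ ℓ ≡ memAt I k′ ℓ
memAt-updateAt-other (r ∷ I) F.zero    g zero     ℓ k′≢k = contradiction refl k′≢k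
memAt-updateAt-other (r ∷ I) F.zero    g (suc k′) ℓ k′≢k = refl
memAt-updateAt-other (r ∷ I) (F.suc k) g zero     ℓ k′≢k = refl
memAt-updateAt-other (r ∷ I) (F.suc k) g (suc k′) ℓ k′≢k =
  memAt-updateAt-other I k g k′ ℓ (λ e → k′≢k (cong suc e))

flipAt-same : ∀ {a b} (J : Subset a b) (k : Fin a) (ℓ : Fin b) →
  memAt (flipAt (k , ℓ) J) (toℕ k) (toℕ ℓ) ≡ not (memAt J (toℕ k) (toℕ ℓ))
flipAt-same J k ℓ = trans (memAt-updateAt-same J k _ (toℕ ℓ))
  (trans (rowAt-updateAt-same (lookup J k) ℓ not) (cong not (rowAt-lookup J k (toℕ ℓ))))

flipAt-other : ∀ {a b} (J : Subset a b) (k : Fin a) (ℓ : Fin b) k′ ℓ′ →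
  ¬ (k′ ≡ toℕ k × ℓ′ ≡ toℕ ℓ) → memAt (flipAt (k , ℓ) J) k′ ℓ′ ≡ memAt J k′ ℓ′
flipAt-other J k ℓ k′ ℓ′ ne with k′ ≟ toℕ k
... | no  k′≢k = memAt-updateAt-other J k _ k′ ℓ′ k′≢k
... | yes refl = trans (memAt-updateAt-same J k _ ℓ′)
  (trans (rowAt-updateAt-other (lookup J k) ℓ not ℓ′ (λ e → ne (refl , e))) (rowAt-lookup J k ℓ′))

Downset : (ℕ → ℕ → Bool) → Set
Downset m = ∀ k ℓ k′ ℓ′ → k′ ≤ k → ℓ′ ≤ ℓ → m k ℓ ≡ true → m k′ ℓ′ ≡ true

ideal⇒downset : ∀ {a b} (I : Subset a b) → IsIdeal I → Downset (memAt I)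
ideal⇒downset I ideal k ℓ k′ ℓ′ k′≤k ℓ′≤ℓ x∈I with memAt-bound I k ℓ x∈I
... | k<a , ℓ<b =
  let k′<a = ≤-<-trans k′≤k k<a
      ℓ′<b = ≤-<-trans ℓ′≤ℓ ℓ<b
      below = subst₂ _≤_ (sym (FP.toℕ-fromℕ< k′<a)) (sym (FP.toℕ-fromℕ< k<a)) k′≤k
            , subst₂ _≤_ (sym (FP.toℕ-fromℕ< ℓ′<b)) (sym (FP.toℕ-fromℕ< ℓ<b)) ℓ′≤ℓ
  in trans (sym (lookup-fromℕ< I k′<a ℓ′<b))
       (ideal _ _ _ _ below (trans (lookup-fromℕ< I k<a ℓ<b) x∈I))

downset⇒ideal : ∀ {a b} (I : Subset a b) → Downset (memAt I) → IsIdeal I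
downset⇒ideal I down k k′ ℓ ℓ′ (k′≤k , ℓ′≤ℓ) x∈I =
  trans (lookup-memAt I k′ ℓ′)
    (down (toℕ k) (toℕ ℓ) (toℕ k′) (toℕ ℓ′) k′≤k ℓ′≤ℓ (trans (sym (lookup-memAt I k ℓ)) x∈I))

above-a-cover : ∀ {k ℓ k′ ℓ′} → k ≤ k′ → ℓ ≤ ℓ′ → ¬ (k′ ≡ k × ℓ′ ≡ ℓ) →
  (k < k′ × ℓ ≤ ℓ′) ⊎ (k ≤ k′ × ℓ < ℓ′)
above-a-cover {k} {ℓ} {k′} {ℓ′} k≤k′ ℓ≤ℓ′ ne with k′ ≟ k
... | yes refl = inj₂ (≤-refl , ≤∧≢⇒< ℓ≤ℓ′ (λ e → ne (refl , sym e)))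
... | no  k′≢k = inj₁ (≤∧≢⇒< k≤k′ (λ e → k′≢k (sym e)) , ℓ≤ℓ′)

-- The lower covers (k−1,ℓ) and (k,ℓ−1) of (k,ℓ), a missing one counting as
-- present.
lowerCoverK : (ℕ → ℕ → Bool) → ℕ → ℕ → Bool
lowerCoverK m zero    ℓ = true
lowerCoverK m (suc k) ℓ = m k ℓ

lowerCoverL : (ℕ → ℕ → Bool) → ℕ → ℕ → Bool
lowerCoverL m k zero    = true
lowerCoverL m k (suc ℓ) = m k ℓ

lowerCoverK-intro : ∀ m k ℓ → (∀ k′ → k ≡ suc k′ → m k′ ℓ ≡ true) → lowerCoverK m k ℓ ≡ true
lowerCoverK-intro m zero    ℓ h = refl
lowerCoverK-intro m (suc k) ℓ h = h k refl

lowerCoverL-intro : ∀ m k ℓ → (∀ ℓ′ → ℓ ≡ suc ℓ′ → m k ℓ′ ≡ true) → lowerCoverL m k ℓ ≡ true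
lowerCoverL-intro m k zero    h = refl
lowerCoverL-intro m k (suc ℓ) h = h ℓ refl

lowerCoverK-below : ∀ m {k ℓ k′ ℓ′} → Downset m → lowerCoverK m k ℓ ≡ true →
  k′ < k → ℓ′ ≤ ℓ → m k′ ℓ′ ≡ true
lowerCoverK-below m {suc k} down h (s≤s k′≤k) ℓ′≤ℓ = down k _ _ _ k′≤k ℓ′≤ℓ h

lowerCoverL-below : ∀ m {k ℓ k′ ℓ′} → Downset m → lowerCoverL m k ℓ ≡ true →
  k′ ≤ k → ℓ′ < ℓ → m k′ ℓ′ ≡ true
lowerCoverL-below m {ℓ = suc ℓ} down h k′≤k (s≤s ℓ′≤ℓ) = down _ ℓ _ _ k′≤k ℓ′≤ℓ h

-- The value at (k,ℓ) after the toggle σ_(k,ℓ) on a downset m: a present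
-- element stays iff one of its upper covers is present, an absent one
-- enters iff both of its lower covers are present.
toggleRule : (ℕ → ℕ → Bool) → ℕ → ℕ → Bool
toggleRule m k ℓ =
  if m k ℓ then m (suc k) ℓ ∨ m k (suc ℓ) else lowerCoverK m k ℓ ∧ lowerCoverL m k ℓ

toggleRule-present : ∀ m {k ℓ} → m k ℓ ≡ true → toggleRule m k ℓ ≡ (m (suc k) ℓ ∨ m k (suc ℓ))
toggleRule-present m {k} {ℓ} h =
  cong (λ c → if c then m (suc k) ℓ ∨ m k (suc ℓ) else lowerCoverK m k ℓ ∧ lowerCoverL m k ℓ) h

toggleRule-absent : ∀ m {k ℓ} → m k ℓ ≡ false →
  toggleRule m k ℓ ≡ (lowerCoverK m k ℓ ∧ lowerCoverL m k ℓ)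
toggleRule-absent m {k} {ℓ} h =
  cong (λ c → if c then m (suc k) ℓ ∨ m k (suc ℓ) else lowerCoverK m k ℓ ∧ lowerCoverL m k ℓ) h

true≢false : true ≢ false
true≢false ()

-- m′ is the downset m with the value at x = (kx,ℓx) flipped.  Whether m′ is
-- again a downset is decided by the covers of x, which gives the toggle rule.
module Flip (m m′ : ℕ → ℕ → Bool) (kx ℓx : ℕ) (down : Downset m)
  (flip-here : m′ kx ℓx ≡ not (m kx ℓx))
  (flip-elsewhere : ∀ k ℓ → ¬ (k ≡ kx × ℓ ≡ ℓx) → m′ k ℓ ≡ m k ℓ) where

  removal-above-absent : Downset m′ → m kx ℓx ≡ true →
    ∀ k ℓ → kx ≤ k → ℓx ≤ ℓ → ¬ (k ≡ kx × ℓ ≡ ℓx) → m k ℓ ≡ false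
  removal-above-absent down′ x∈m k ℓ kx≤k ℓx≤ℓ ne = ¬-not λ y∈m →
    true≢false (trans (sym (down′ k ℓ kx ℓx kx≤k ℓx≤ℓ (trans (flip-elsewhere k ℓ ne) y∈m)))
                      (trans flip-here (cong not x∈m)))

  addition-below-present : Downset m′ → m kx ℓx ≡ false →
    ∀ k ℓ → k ≤ kx → ℓ ≤ ℓx → ¬ (k ≡ kx × ℓ ≡ ℓx) → m k ℓ ≡ true
  addition-below-present down′ x∉m k ℓ k≤kx ℓ≤ℓx ne =
    trans (sym (flip-elsewhere k ℓ ne))
      (down′ kx ℓx k ℓ k≤kx ℓ≤ℓx (trans flip-here (cong not x∉m)))

  removal-downset : m kx ℓx ≡ true → m (suc kx) ℓx ≡ false → m kx (suc ℓx) ≡ false →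
    Downset m′
  removal-downset x∈m up₁ up₂ k ℓ k′ ℓ′ k′≤k ℓ′≤ℓ y∈m′
    with (k ≟ kx) ×-dec (ℓ ≟ ℓx) | (k′ ≟ kx) ×-dec (ℓ′ ≟ ℓx)
  ... | yes (refl , refl) | _ =
    contradiction (trans (sym y∈m′) (trans flip-here (cong not x∈m))) true≢false
  ... | no y≢x | no y′≢x =
    trans (flip-elsewhere k′ ℓ′ y′≢x) (down k ℓ k′ ℓ′ k′≤k ℓ′≤ℓ (trans (sym (flip-elsewhere k ℓ y≢x)) y∈m′))
  ... | no y≢x | yes (refl , refl) with above-a-cover k′≤k ℓ′≤ℓ y≢x
  ...   | inj₁ (kx<k , ℓx≤ℓ) = contradiction
            (trans (sym (down k ℓ (suc kx) ℓx kx<k ℓx≤ℓ (trans (sym (flip-elsewhere k ℓ y≢x)) y∈m′))) up₁)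
            true≢false
  ...   | inj₂ (kx≤k , ℓx<ℓ) = contradiction
            (trans (sym (down k ℓ kx (suc ℓx) kx≤k ℓx<ℓ (trans (sym (flip-elsewhere k ℓ y≢x)) y∈m′))) up₂)
            true≢false

  addition-downset : m kx ℓx ≡ false → lowerCoverK m kx ℓx ≡ true → lowerCoverL m kx ℓx ≡ true →
    Downset m′
  addition-downset x∉m low₁ low₂ k ℓ k′ ℓ′ k′≤k ℓ′≤ℓ y∈m′
    with (k′ ≟ kx) ×-dec (ℓ′ ≟ ℓx) | (k ≟ kx) ×-dec (ℓ ≟ ℓx)
  ... | yes (refl , refl) | _ = trans flip-here (cong not x∉m)
  ... | no y′≢x | no y≢x =
    trans (flip-elsewhere k′ ℓ′ y′≢x) (down k ℓ k′ ℓ′ k′≤k ℓ′≤ℓ (trans (sym (flip-elsewhere k ℓ y≢x)) y∈m′))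
  ... | no y′≢x | yes (refl , refl) with above-a-cover k′≤k ℓ′≤ℓ (λ (p , q) → y′≢x (sym p , sym q))
  ...   | inj₁ (k′<kx , ℓ′≤ℓx) =
            trans (flip-elsewhere k′ ℓ′ y′≢x) (lowerCoverK-below m down low₁ k′<kx ℓ′≤ℓx)
  ...   | inj₂ (k′≤kx , ℓ′<ℓx) =
            trans (flip-elsewhere k′ ℓ′ y′≢x) (lowerCoverL-below m down low₂ k′≤kx ℓ′<ℓx)

  flipped-value : Downset m′ → m′ kx ℓx ≡ toggleRule m kx ℓx
  flipped-value down′ = by-value (m kx ℓx) refl
    where
    by-value : ∀ v → m kx ℓx ≡ v → m′ kx ℓx ≡ toggleRule m kx ℓx
    by-value true x∈m = begin
      m′ kx ℓx                       ≡⟨ trans flip-here (cong not x∈m) ⟩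
      false ∨ false                  ≡⟨ cong₂ _∨_ cover₁ cover₂ ⟨
      m (suc kx) ℓx ∨ m kx (suc ℓx)  ≡⟨ toggleRule-present m x∈m ⟨
      toggleRule m kx ℓx             ∎
      where
      above = removal-above-absent down′ x∈m
      cover₁ : m (suc kx) ℓx ≡ false
      cover₁ = above (suc kx) ℓx (n≤1+n kx) ≤-refl (λ (p , _) → 1+n≢n p)
      cover₂ : m kx (suc ℓx) ≡ false
      cover₂ = above kx (suc ℓx) ≤-refl (n≤1+n ℓx) (λ (_ , q) → 1+n≢n q)
    by-value false x∉m = begin
      m′ kx ℓx                                   ≡⟨ trans flip-here (cong not x∉m) ⟩
      true ∧ true                                ≡⟨ cong₂ _∧_ cover₁ cover₂ ⟨
      lowerCoverK m kx ℓx ∧ lowerCoverL m kx ℓx  ≡⟨ toggleRule-absent m x∉m ⟨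
      toggleRule m kx ℓx                         ∎
      where
      below = addition-below-present down′ x∉m
      cover₁ : lowerCoverK m kx ℓx ≡ true
      cover₁ = lowerCoverK-intro m kx ℓx λ k e →
        below k ℓx (subst (k ≤_) (sym e) (n≤1+n k)) ≤-refl (λ (p , _) → 1+n≢n (sym (trans p e)))
      cover₂ : lowerCoverL m kx ℓx ≡ true
      cover₂ = lowerCoverL-intro m kx ℓx λ ℓ e →
        below kx ℓ ≤-refl (subst (ℓ ≤_) (sym e) (n≤1+n ℓ)) (λ (_ , q) → 1+n≢n (sym (trans q e)))

  unflipped-value : ¬ Downset m′ → m kx ℓx ≡ toggleRule m kx ℓx
  unflipped-value ¬down′ = by-value (m kx ℓx) refl
    where
    by-value : ∀ v → m kx ℓx ≡ v → m kx ℓx ≡ toggleRule m kx ℓx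
    by-value true x∈m = trans x∈m (sym (trans (toggleRule-present m x∈m) (some-cover _ _ refl refl)))
      where
      some-cover : ∀ u v → m (suc kx) ℓx ≡ u → m kx (suc ℓx) ≡ v → (u ∨ v) ≡ true
      some-cover true  _     _  _  = refl
      some-cover false true  _  _  = refl
      some-cover false false c₁ c₂ = contradiction (removal-downset x∈m c₁ c₂) ¬down′
    by-value false x∉m = trans x∉m (sym (trans (toggleRule-absent m x∉m) (some-cover _ _ refl refl)))
      where
      some-cover : ∀ u v → lowerCoverK m kx ℓx ≡ u → lowerCoverL m kx ℓx ≡ v → (u ∧ v) ≡ false
      some-cover false _     _  _  = refl
      some-cover true  false _  _  = refl
      some-cover true  true  c₁ c₂ = contradiction (addition-downset x∉m c₁ c₂) ¬down′

if-dec-cases : ∀ {P X : Set} (d : Dec P) (A B : X) →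
  ((if does d then A else B) ≡ A × P) ⊎ ((if does d then A else B) ≡ B × ¬ P)
if-dec-cases (yes p) A B = inj₁ (refl , p)
if-dec-cases (no ¬p) A B = inj₂ (refl , ¬p)

toggle-cases : ∀ {a b} (x : Elt a b) (J : Subset a b) →
  (toggle x J ≡ flipAt x J × IsIdeal (flipAt x J)) ⊎ (toggle x J ≡ J × ¬ IsIdeal (flipAt x J))
toggle-cases x J = if-dec-cases (isIdeal? (flipAt x J)) (flipAt x J) J

toggle-preserves-ideal : ∀ {a b} (x : Elt a b) (J : Subset a b) → IsIdeal J → IsIdeal (toggle x J)
toggle-preserves-ideal x J ideal with toggle-cases x J
... | inj₁ (eq , flip-ideal) = subst IsIdeal (sym eq) flip-ideal
... | inj₂ (eq , _)          = subst IsIdeal (sym eq) ideal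

toggle-elsewhere : ∀ {a b} (J : Subset a b) (k : Fin a) (ℓ : Fin b) k′ ℓ′ →
  ¬ (k′ ≡ toℕ k × ℓ′ ≡ toℕ ℓ) → memAt (toggle (k , ℓ) J) k′ ℓ′ ≡ memAt J k′ ℓ′
toggle-elsewhere J k ℓ k′ ℓ′ ne with toggle-cases (k , ℓ) J
... | inj₁ (eq , _) = trans (cong (λ S → memAt S k′ ℓ′) eq) (flipAt-other J k ℓ k′ ℓ′ ne)
... | inj₂ (eq , _) = cong (λ S → memAt S k′ ℓ′) eq

toggle-here : ∀ {a b} (J : Subset a b) (k : Fin a) (ℓ : Fin b) → IsIdeal J →
  memAt (toggle (k , ℓ) J) (toℕ k) (toℕ ℓ) ≡ toggleRule (memAt J) (toℕ k) (toℕ ℓ)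
toggle-here J k ℓ ideal with toggle-cases (k , ℓ) J
... | inj₁ (eq , flip-ideal) = trans (cong (λ S → memAt S (toℕ k) (toℕ ℓ)) eq)
        (flipped-value (ideal⇒downset (flipAt (k , ℓ) J) flip-ideal))
  where open Flip (memAt J) (memAt (flipAt (k , ℓ) J)) (toℕ k) (toℕ ℓ) (ideal⇒downset J ideal)
                  (flipAt-same J k ℓ) (flipAt-other J k ℓ)
... | inj₂ (eq , ¬flip-ideal) = trans (cong (λ S → memAt S (toℕ k) (toℕ ℓ)) eq)
        (unflipped-value (λ down′ → ¬flip-ideal (downset⇒ideal (flipAt (k , ℓ) J) down′)))
  where open Flip (memAt J) (memAt (flipAt (k , ℓ) J)) (toℕ k) (toℕ ℓ) (ideal⇒downset J ideal)
                  (flipAt-same J k ℓ) (flipAt-other J k ℓ)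

toList-tabulate : ∀ {A : Set} n (f : Fin n → A) → toList (V.tabulate f) ≡ L.tabulate f
toList-tabulate zero    f = refl
toList-tabulate (suc n) f = cong (f F.zero ∷_) (toList-tabulate n (λ i → f (F.suc i)))

concatMap-pairs : ∀ {A B : Set} (xs : List A) (ys : List B) →
  concatMap (λ x → map (λ y → (x , y)) ys) xs ≡ cartesianProduct xs ys
concatMap-pairs []       ys = refl
concatMap-pairs (x ∷ xs) ys = cong (map (x ,_) ys L.++_) (concatMap-pairs xs ys)

allElts-product : ∀ a b → allElts a b ≡ cartesianProduct (L.allFin a) (L.allFin b)
allElts-product a b rewrite toList-tabulate a (λ i → i) | toList-tabulate b (λ i → i) =
  concatMap-pairs (L.allFin a) (L.allFin b)

allElts-complete : ∀ {a b} (y : Elt a b) → y ∈ allElts a b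
allElts-complete {a} {b} (k , ℓ) rewrite allElts-product a b =
  ∈-cartesianProduct⁺ (∈-allFin k) (∈-allFin ℓ)

allElts-unique : ∀ a b → Unique (allElts a b)
allElts-unique a b rewrite allElts-product a b =
  Uniqueₚ.cartesianProduct⁺ (Uniqueₚ.allFin⁺ a) (Uniqueₚ.allFin⁺ b)

diag≤⇒ℕ : ∀ p q r s → (ℤ.+ p - ℤ.+ q) ≤ℤ (ℤ.+ r - ℤ.+ s) → p + s ≤ r + q
diag≤⇒ℕ p q r s h = ℤₚ.drop‿+≤+ (subst₂ _≤ℤ_
  (trans (cancelˡ (ℤ.+ p) (ℤ.+ q) (ℤ.+ s)) (sym (ℤₚ.pos-+ p s)))
  (trans (cancelʳ (ℤ.+ r) (ℤ.+ s) (ℤ.+ q)) (sym (ℤₚ.pos-+ r q)))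
  (ℤₚ.+-monoˡ-≤ (ℤ.+ q ℤ.+ ℤ.+ s) h))
  where
  cancelˡ : ∀ (x y z : ℤ) → (x - y) ℤ.+ (y ℤ.+ z) ≡ x ℤ.+ z
  cancelˡ = solveℤ-∀
  cancelʳ : ∀ (x y z : ℤ) → (x - y) ℤ.+ (z ℤ.+ y) ≡ x ℤ.+ z
  cancelʳ = solveℤ-∀

-- The closed form of promotion on [a′+1] × [b], given the value B of the
-- corner (a′,0): if B holds, the whole column ℓ = 0 is present and ∂I is I
-- shifted by one in ℓ; otherwise the row k = a′ is empty and ∂I is I shifted
-- by one in k, with a full row k = 0 entering.
promoted : Bool → (ℕ → ℕ → Bool) → ℕ → ℕ → Bool
promoted true  mi k       ℓ = mi k (suc ℓ)
promoted false mi zero    ℓ = true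
promoted false mi (suc k) ℓ = mi k ℓ

-- The state m of the sweep around x = (k,ℓ) at the moment x is toggled: x and
-- its later neighbours (k−1,ℓ), (k,ℓ+1) still carry the initial values mi,
-- its earlier neighbours (k+1,ℓ), (k,ℓ−1) already carry the final values.
record Frontier (a′ : ℕ) (mi final m : ℕ → ℕ → Bool) (k ℓ : ℕ) : Set where
  field
    at-x   : m k ℓ ≡ mi k ℓ
    next-ℓ : m k (suc ℓ) ≡ mi k (suc ℓ)
    prev-k : ∀ {k′} → k ≡ suc k′ → m k′ ℓ ≡ mi k′ ℓ
    next-k : suc k ≤ a′ → m (suc k) ℓ ≡ final (suc k) ℓ
    prev-ℓ : ∀ {ℓ′} → ℓ ≡ suc ℓ′ → m k ℓ′ ≡ final k ℓ′

-- At such a frontier the toggle rule produces exactly the closed form.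
-- mi is the initial downset, m the current state (supported in rows ≤ a′).
module FrontierToggle (a′ : ℕ) (mi m : ℕ → ℕ → Bool) (down : Downset mi)
  (supported : ∀ k ℓ → m k ℓ ≡ true → k ≤ a′) where

  shift-ℓ-present : ∀ {k ℓ} → Frontier a′ mi (promoted true mi) m k ℓ → mi k ℓ ≡ true →
    toggleRule m k ℓ ≡ mi k (suc ℓ)
  shift-ℓ-present {k} {ℓ} fr x∈ =
    trans (toggleRule-present m (trans at-x x∈)) (upper (m (suc k) ℓ) refl)
    where
    open Frontier fr
    upper : ∀ v → m (suc k) ℓ ≡ v → (v ∨ m k (suc ℓ)) ≡ mi k (suc ℓ)
    upper false _ = next-ℓ
    upper true  e = sym (down (suc k) (suc ℓ) k (suc ℓ) (n≤1+n k) ≤-refl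
                         (trans (sym (next-k (supported (suc k) ℓ e))) e))

  -- Corner present, x absent: x stays absent, as (k,ℓ−1) has already left.
  shift-ℓ-absent : ∀ {k ℓ} → Frontier a′ mi (promoted true mi) m k ℓ →
    mi a′ 0 ≡ true → k ≤ a′ → mi k ℓ ≡ false → toggleRule m k ℓ ≡ mi k (suc ℓ)
  shift-ℓ-absent {k} {zero} fr corner k≤a′ x∉ =
    contradiction (trans (sym (down a′ 0 k 0 k≤a′ ≤-refl corner)) x∉) λ ()
  shift-ℓ-absent {k} {suc ℓ} fr corner k≤a′ x∉ = begin
    toggleRule m k (suc ℓ)                         ≡⟨ toggleRule-absent m (trans at-x x∉) ⟩
    lowerCoverK m k (suc ℓ) ∧ m k ℓ                ≡⟨ cong (lowerCoverK m k (suc ℓ) ∧_) (trans (prev-ℓ refl) x∉) ⟩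
    lowerCoverK m k (suc ℓ) ∧ false                ≡⟨ ∧-zeroʳ _ ⟩
    false                                          ≡⟨ next-absent ⟨
    mi k (suc (suc ℓ))                             ∎
    where
    open Frontier fr
    next-absent : mi k (suc (suc ℓ)) ≡ false
    next-absent = ¬-not λ y∈ → contradiction (trans (sym (down k _ k (suc ℓ) ≤-refl (n≤1+n _) y∈)) x∉) λ ()

  promoted-false-present : ∀ k ℓ → mi k ℓ ≡ true → promoted false mi k ℓ ≡ true
  promoted-false-present zero    ℓ _  = refl
  promoted-false-present (suc k) ℓ x∈ = down (suc k) ℓ k ℓ (n≤1+n k) ≤-refl x∈

  -- Corner absent, x present: x stays, as (k+1,ℓ) has already entered.
  shift-k-present : ∀ {k ℓ} → Frontier a′ mi (promoted false mi) m k ℓ →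
    mi a′ 0 ≡ false → k ≤ a′ → mi k ℓ ≡ true → toggleRule m k ℓ ≡ promoted false mi k ℓ
  shift-k-present {k} {ℓ} fr corner k≤a′ x∈ = begin
    toggleRule m k ℓ                ≡⟨ toggleRule-present m (trans at-x x∈) ⟩
    m (suc k) ℓ ∨ m k (suc ℓ)       ≡⟨ cong (_∨ m k (suc ℓ)) (trans (next-k k<a′) x∈) ⟩
    true                            ≡⟨ promoted-false-present k ℓ x∈ ⟨
    promoted false mi k ℓ           ∎
    where
    open Frontier fr
    -- x is not in row a′, since that row is empty
    k<a′ : suc k ≤ a′
    k<a′ = ≤∧≢⇒< k≤a′ λ { refl → contradiction (trans (sym (down k ℓ k 0 ≤-refl z≤n x∈)) corner) λ () }

  shift-k-absent : ∀ {k ℓ} → Frontier a′ mi (promoted false mi) m k ℓ → mi k ℓ ≡ false →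
    toggleRule m k ℓ ≡ promoted false mi k ℓ
  shift-k-absent {k} {ℓ} fr x∉ = trans (toggleRule-absent m (trans (Frontier.at-x fr) x∉)) (covers k ℓ fr)
    where
    covers : ∀ k ℓ → Frontier a′ mi (promoted false mi) m k ℓ →
      (lowerCoverK m k ℓ ∧ lowerCoverL m k ℓ) ≡ promoted false mi k ℓ
    covers zero    zero    fr = refl
    covers zero    (suc ℓ) fr = Frontier.prev-ℓ fr refl
    covers (suc k) zero    fr = trans (∧-identityʳ _) (Frontier.prev-k fr refl)
    covers (suc k) (suc ℓ) fr = begin
      m k (suc ℓ) ∧ m (suc k) ℓ     ≡⟨ cong₂ _∧_ (Frontier.prev-k fr refl) (Frontier.prev-ℓ fr refl) ⟩
      mi k (suc ℓ) ∧ mi k ℓ         ≡⟨ absorb (mi k (suc ℓ)) refl ⟩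
      mi k (suc ℓ)                  ∎
      where
      absorb : ∀ v → mi k (suc ℓ) ≡ v → (v ∧ mi k ℓ) ≡ v
      absorb false _  = refl
      absorb true  y∈ = down k (suc ℓ) k ℓ ≤-refl (n≤1+n ℓ) y∈

  frontier-toggle : ∀ {k ℓ} B → mi a′ 0 ≡ B → k ≤ a′ → Frontier a′ mi (promoted B mi) m k ℓ →
    toggleRule m k ℓ ≡ promoted B mi k ℓ
  frontier-toggle {k} {ℓ} true corner k≤a′ fr = by-value (mi k ℓ) refl
    where
    by-value : ∀ v → mi k ℓ ≡ v → toggleRule m k ℓ ≡ promoted true mi k ℓ
    by-value true  x∈ = shift-ℓ-present fr x∈
    by-value false x∉ = shift-ℓ-absent fr corner k≤a′ x∉
  frontier-toggle {k} {ℓ} false corner k≤a′ fr = by-value (mi k ℓ) refl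
    where
    by-value : ∀ v → mi k ℓ ≡ v → toggleRule m k ℓ ≡ promoted false mi k ℓ
    by-value true  x∈ = shift-k-present fr corner k≤a′ x∈
    by-value false x∉ = shift-k-absent fr x∉

AllPairs-across : ∀ {A : Set} {R : A → A → Set} (p : List A) {q x y} →
  AllPairs R (p ++ q) → x ∈ p → y ∈ q → R x y
AllPairs-across (_ ∷ p) (h ∷ _)  (here refl) y∈q = All.lookup h (∈-++⁺ʳ p y∈q)
AllPairs-across (_ ∷ p) (_ ∷ hs) (there x∈p) y∈q = AllPairs-across p hs x∈p y∈q

AllPairs-suffix : ∀ {A : Set} {R : A → A → Set} (p : List A) {q} → AllPairs R (p ++ q) → AllPairs R q
AllPairs-suffix []      h        = h
AllPairs-suffix (_ ∷ p) (_ ∷ hs) = AllPairs-suffix p hs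

module Sweep (a′ b : ℕ) where

  Pt : Set
  Pt = Elt (suc a′) b

  _⊑_ : Pt → Pt → Set
  (k , ℓ) ⊑ (k′ , ℓ′) = toℕ ℓ + toℕ k′ ≤ toℕ ℓ′ + toℕ k

  Schedule : List Pt → Set
  Schedule l = AllPairs _⊑_ l × Unique l × (∀ y → y ∈ l)

  enumeration-schedule : (e : List Pt) → IsDiagEnumeration e → Schedule e
  enumeration-schedule e (e↭P , sorted) =
      AllPairs.map (λ {x} {y} → ⊑-from-diag x y) (Linked⇒AllPairs ℤₚ.≤-trans sorted)
    , PermSetoid.Unique-resp-↭ (setoid Pt) (↭⇒↭ₛ (↭-sym e↭P)) (allElts-unique (suc a′) b)
    , λ y → ∈-resp-↭ (↭-sym e↭P) (allElts-complete y)
    where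
    ⊑-from-diag : ∀ x y → diag x ≤ℤ diag y → x ⊑ y
    ⊑-from-diag (k , ℓ) (k′ , ℓ′) = diag≤⇒ℕ (toℕ ℓ) (toℕ k) (toℕ ℓ′) (toℕ k′)

  valueAt : Subset (suc a′) b → Pt → Bool
  valueAt J (k , ℓ) = memAt J (toℕ k) (toℕ ℓ)

  point : ∀ {k ℓ} → k < suc a′ → ℓ < b → Pt
  point k<a ℓ<b = fromℕ< k<a , fromℕ< ℓ<b

  at-point : ∀ (g : ℕ → ℕ → Bool) {k ℓ} (k<a : k < suc a′) (ℓ<b : ℓ < b) →
    g (toℕ (fromℕ< k<a)) (toℕ (fromℕ< ℓ<b)) ≡ g k ℓ
  at-point g k<a ℓ<b = cong₂ g (FP.toℕ-fromℕ< k<a) (FP.toℕ-fromℕ< ℓ<b)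

  module _ (I : Subset (suc a′) b) (ideal : IsIdeal I) where

    corner : Bool
    corner = memAt I a′ 0

    final : ℕ → ℕ → Bool
    final = promoted corner (memAt I)

    Processed : List Pt → Subset (suc a′) b → Set
    Processed p J = ∀ y → (y ∈ p → valueAt J y ≡ final (toℕ (proj₁ y)) (toℕ (proj₂ y)))
                        × (y ∉ p → valueAt J y ≡ valueAt I y)

    module Next (p s : List Pt) (K : Fin (suc a′)) (L : Fin b)
      (sched : Schedule (p ++ (K , L) ∷ s)) (J : Subset (suc a′) b) (done : Processed p J) where

      earlier-final : ∀ {k ℓ} (k<a : k < suc a′) (ℓ<b : ℓ < b) → ℓ + toℕ K < toℕ L + k →
        memAt J k ℓ ≡ final k ℓ
      earlier-final {k} {ℓ} k<a ℓ<b earlier =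
        trans (sym (at-point (memAt J) k<a ℓ<b))
          (trans (proj₁ (done y) y∈p) (at-point final k<a ℓ<b))
        where
        y = point k<a ℓ<b
        ¬x⊑y : ¬ ((K , L) ⊑ y)
        ¬x⊑y x⊑y = <⇒≱ earlier (subst₂ (λ u v → toℕ L + u ≤ v + toℕ K)
                      (FP.toℕ-fromℕ< k<a) (FP.toℕ-fromℕ< ℓ<b) x⊑y)
        y∈p : y ∈ p
        y∈p with ∈-++⁻ p (proj₂ (proj₂ sched) y)
        ... | inj₁ y∈p         = y∈p
        ... | inj₂ (here refl) = contradiction ≤-refl ¬x⊑y
        ... | inj₂ (there y∈s) with AllPairs-suffix p (proj₁ sched)
        ...   | x⊑s ∷ _ = contradiction (All.lookup x⊑s y∈s) ¬x⊑y

      later-initial : ∀ {k ℓ} (k<a : k < suc a′) (ℓ<b : ℓ < b) → toℕ L + k < ℓ + toℕ K →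
        memAt J k ℓ ≡ memAt I k ℓ
      later-initial {k} {ℓ} k<a ℓ<b later =
        trans (sym (at-point (memAt J) k<a ℓ<b))
          (trans (proj₂ (done y) y∉p) (at-point (memAt I) k<a ℓ<b))
        where
        y = point k<a ℓ<b
        y∉p : y ∉ p
        y∉p y∈p = <⇒≱ later (subst₂ (λ u v → v + toℕ K ≤ toℕ L + u)
                    (FP.toℕ-fromℕ< k<a) (FP.toℕ-fromℕ< ℓ<b)
                    (AllPairs-across p (proj₁ sched) y∈p (here refl)))

      x-initial : memAt J (toℕ K) (toℕ L) ≡ memAt I (toℕ K) (toℕ L)
      x-initial = proj₂ (done (K , L)) λ x∈p →
        AllPairs-across p (proj₁ (proj₂ sched)) x∈p (here refl) refl

      -- Hence the covers of x form a frontier (a cover beyond the last column is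
      -- absent in every state).
      frontier : Frontier a′ (memAt I) final (memAt J) (toℕ K) (toℕ L)
      frontier = record
        { at-x   = x-initial
        ; next-ℓ = next-ℓ
        ; prev-k = λ {k′} e → later-initial (k′<a e) ℓ<b (subst (λ u → ℓ + k′ < ℓ + u) (sym e) (+-monoʳ-< ℓ ≤-refl))
        ; next-k = λ k<a′ → earlier-final (s≤s k<a′) ℓ<b (+-monoʳ-< ℓ ≤-refl)
        ; prev-ℓ = λ {ℓ′} e → earlier-final k<a (ℓ′<b e) (subst (λ u → ℓ′ + k < u + k) (sym e) ≤-refl)
        }
        where
        k = toℕ K
        ℓ = toℕ L
        k<a = FP.toℕ<n K
        ℓ<b = FP.toℕ<n L
        k′<a : ∀ {k′} → k ≡ suc k′ → k′ < suc a′
        k′<a e = ≤-trans (n≤1+n _) (subst (_< suc a′) e k<a)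
        ℓ′<b : ∀ {ℓ′} → ℓ ≡ suc ℓ′ → ℓ′ < b
        ℓ′<b e = ≤-trans (n≤1+n _) (subst (_< b) e ℓ<b)
        next-ℓ : memAt J k (suc ℓ) ≡ memAt I k (suc ℓ)
        next-ℓ with suc ℓ <? b
        ... | yes ℓ+1<b = later-initial k<a ℓ+1<b ≤-refl
        ... | no  ℓ+1≮b = trans (memAt-beyond J k (suc ℓ) ℓ+1≮b) (sym (memAt-beyond I k (suc ℓ) ℓ+1≮b))

    sweep-step : ∀ p x s → Schedule (p ++ x ∷ s) → ∀ J → IsIdeal J → Processed p J →
      Processed (p ++ [ x ]) (toggle x J)
    sweep-step p (K , L) s sched J idealJ done y with ≡-dec FP._≟_ FP._≟_ y (K , L)
    ... | no y≢x = (λ y∈p′ → trans unchanged (proj₁ (done y) (earlier y∈p′)))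
                 , (λ y∉p′ → trans unchanged (proj₂ (done y) (λ y∈p → y∉p′ (∈-++⁺ˡ y∈p))))
      where
      unchanged : valueAt (toggle (K , L) J) y ≡ valueAt J y
      unchanged = toggle-elsewhere J K L _ _ λ (e₁ , e₂) →
        y≢x (cong₂ _,_ (FP.toℕ-injective e₁) (FP.toℕ-injective e₂))
      earlier : y ∈ p ++ [ (K , L) ] → y ∈ p
      earlier y∈p′ with ∈-++⁻ p y∈p′
      ... | inj₁ y∈p      = y∈p
      ... | inj₂ (here e) = contradiction e y≢x
    ... | yes refl = (λ _ → trans (toggle-here J K L idealJ) toggled)
                   , (λ x∉p′ → contradiction (∈-++⁺ʳ p (here refl)) x∉p′)
      where
      open FrontierToggle a′ (memAt I) (memAt J) (ideal⇒downset I ideal)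
        (λ k ℓ k∈ → ≤-pred (proj₁ (memAt-bound J k ℓ k∈)))
      toggled : toggleRule (memAt J) (toℕ K) (toℕ L) ≡ final (toℕ K) (toℕ L)
      toggled = frontier-toggle corner refl (≤-pred (FP.toℕ<n K)) (Next.frontier p s K L sched J done)

    sweep : ∀ p s → Schedule (p ++ s) → ∀ J → IsIdeal J → Processed p J →
      Processed (p ++ s) (foldl (λ J x → toggle x J) J s)
    sweep p []      sched J idealJ done = subst (λ q → Processed q J) (sym (++-identityʳ p)) done
    sweep p (x ∷ s) sched J idealJ done =
      subst (λ q → Processed q (foldl (λ J x → toggle x J) (toggle x J) s)) reassoc
        (sweep (p ++ [ x ]) s (subst Schedule (sym reassoc) sched)
          (toggle x J) (toggle-preserves-ideal x J idealJ) (sweep-step p x s sched J idealJ done))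
      where
      reassoc : (p ++ [ x ]) ++ s ≡ p ++ x ∷ s
      reassoc = ++-assoc p [ x ] s

    promotion-closed-form : (e : List Pt) → IsDiagEnumeration e →
      ∀ (k : Fin (suc a′)) (ℓ : Fin b) → memAt (promotion e I) (toℕ k) (toℕ ℓ) ≡ final (toℕ k) (toℕ ℓ)
    promotion-closed-form e enum k ℓ =
      proj₁ (sweep [] e sched I ideal (λ y → (λ ()) , (λ _ → refl)) (k , ℓ)) (proj₂ (proj₂ sched) (k , ℓ))
      where
      sched = enumeration-schedule e enum

dropFirst : ∀ {n} → Vec Bool (suc n) → Vec Bool (suc n)
dropFirst (x ∷ r) = r ∷ʳ false

pushRow : ∀ {A : Set} {n} → A → Vec A n → Vec A n
pushRow new []       = []
pushRow new (r ∷ rs) = new ∷ pushRow r rs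

-- The row that 'pushRow new' pushes out.
leavingRow : ∀ {A : Set} {n} → Vec A n → A → A
leavingRow []       new = new
leavingRow (r ∷ rs) new = leavingRow rs r

shifted : ∀ {a b′} → Bool → Subset a (suc b′) → Subset a (suc b′)
shifted true  I = V.map dropFirst I
shifted false I = pushRow (V.replicate _ true) I

rowAt-∷ʳ-false : ∀ {n} (r : Vec Bool n) ℓ → rowAt (r ∷ʳ false) ℓ ≡ rowAt r ℓ
rowAt-∷ʳ-false []      zero    = refl
rowAt-∷ʳ-false []      (suc ℓ) = refl
rowAt-∷ʳ-false (x ∷ r) zero    = refl
rowAt-∷ʳ-false (x ∷ r) (suc ℓ) = rowAt-∷ʳ-false r ℓ

memAt-dropFirst : ∀ {a b′} (I : Subset a (suc b′)) k ℓ →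
  memAt (V.map dropFirst I) k ℓ ≡ memAt I k (suc ℓ)
memAt-dropFirst []              k       ℓ = refl
memAt-dropFirst ((x ∷ r) ∷ I)   zero    ℓ = rowAt-∷ʳ-false r ℓ
memAt-dropFirst (r ∷ I)         (suc k) ℓ = memAt-dropFirst I k ℓ

memAt-pushRow : ∀ {n b} (rs : Vec (Vec Bool b) n) new k ℓ → k < n →
  memAt (pushRow new rs) k ℓ ≡ memAt (new ∷ rs) k ℓ
memAt-pushRow (r ∷ rs) new zero    ℓ _         = refl
memAt-pushRow (r ∷ rs) new (suc k) ℓ (s≤s k<n) = memAt-pushRow rs r k ℓ k<n

rowAt-full : ∀ n ℓ → ℓ < n → rowAt (V.replicate n true) ℓ ≡ true
rowAt-full (suc n) zero    _         = refl
rowAt-full (suc n) (suc ℓ) (s≤s ℓ<n) = rowAt-full n ℓ ℓ<n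

memAt-shifted : ∀ {a b′} B (I : Subset a (suc b′)) k ℓ → k < a → ℓ < suc b′ →
  memAt (shifted B I) k ℓ ≡ promoted B (memAt I) k ℓ
memAt-shifted true  I k       ℓ _   _   = memAt-dropFirst I k ℓ
memAt-shifted false I zero    ℓ k<a ℓ<b = trans (memAt-pushRow I _ zero ℓ k<a) (rowAt-full _ ℓ ℓ<b)
memAt-shifted false I (suc k) ℓ k<a ℓ<b = memAt-pushRow I _ (suc k) ℓ k<a

-- Statistics of a subset I, computed row by row:
--   indexSum r      = Σ of the positions ℓ present in the row r,
--   rowIndexSum I   = Σ_{(k,ℓ)∈I} k,      colIndexSum I = Σ_{(k,ℓ)∈I} ℓ.
indexSum : ∀ {n} → Vec Bool n → ℕ
indexSum []      = 0
indexSum (x ∷ r) = indexSum r + countRow r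

rowIndexSum : ∀ {a b} → Subset a b → ℕ
rowIndexSum []       = 0
rowIndexSum (r ∷ rs) = rowIndexSum rs + card rs

colIndexSum : ∀ {a b} → Subset a b → ℕ
colIndexSum []       = 0
colIndexSum (r ∷ rs) = indexSum r + colIndexSum rs

countRow-∷ʳ-false : ∀ {n} (r : Vec Bool n) → countRow (r ∷ʳ false) ≡ countRow r
countRow-∷ʳ-false []          = refl
countRow-∷ʳ-false (true ∷ r)  = cong suc (countRow-∷ʳ-false r)
countRow-∷ʳ-false (false ∷ r) = countRow-∷ʳ-false r

indexSum-∷ʳ-false : ∀ {n} (r : Vec Bool n) → indexSum (r ∷ʳ false) ≡ indexSum r
indexSum-∷ʳ-false []      = refl
indexSum-∷ʳ-false (x ∷ r) = cong₂ _+_ (indexSum-∷ʳ-false r) (countRow-∷ʳ-false r)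

countRow-full : ∀ n → countRow (V.replicate n true) ≡ n
countRow-full zero    = refl
countRow-full (suc n) = cong suc (countRow-full n)

indexSum-full : ∀ n → indexSum (V.replicate n true) ≡ sumUpTo n (λ i → i)
indexSum-full zero    = refl
indexSum-full (suc n) = cong₂ _+_ (indexSum-full n) (countRow-full n)

countRow-empty : ∀ {n} (r : Vec Bool n) → (∀ ℓ → rowAt r ℓ ≡ false) → countRow r ≡ 0
countRow-empty []          h = refl
countRow-empty (true ∷ r)  h = contradiction (h 0) λ ()
countRow-empty (false ∷ r) h = countRow-empty r (λ ℓ → h (suc ℓ))

indexSum-empty : ∀ {n} (r : Vec Bool n) → countRow r ≡ 0 → indexSum r ≡ 0
indexSum-empty []          h = refl
indexSum-empty (false ∷ r) h = cong₂ _+_ (indexSum-empty r h) h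

StartsFull : ∀ {n b} → Vec (Vec Bool b) n → Set
StartsFull {n} rs = ∀ k → k < n → memAt rs k 0 ≡ true

card-dropFirst : ∀ {n b′} (rs : Vec (Vec Bool (suc b′)) n) → StartsFull rs →
  card rs ≡ card (V.map dropFirst rs) + n
card-dropFirst []                 full = refl
card-dropFirst ((false ∷ r) ∷ rs) full = contradiction (full 0 (s≤s z≤n)) λ ()
card-dropFirst {suc n} ((true ∷ r) ∷ rs) full = begin
  suc (countRow r + card rs)                                 ≡⟨ cong (λ c → suc (countRow r + c)) (card-dropFirst rs (λ k k<n → full (suc k) (s≤s k<n))) ⟩
  suc (countRow r + (card (V.map dropFirst rs) + n))         ≡⟨ regroup (countRow r) (card (V.map dropFirst rs)) n ⟩
  countRow r + card (V.map dropFirst rs) + suc n             ≡⟨ cong (λ c → c + card (V.map dropFirst rs) + suc n) (countRow-∷ʳ-false r) ⟨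
  countRow (r ∷ʳ false) + card (V.map dropFirst rs) + suc n  ∎
  where
  regroup : ∀ x y n → suc (x + (y + n)) ≡ x + y + suc n
  regroup = solve-∀

rowIndexSum-dropFirst : ∀ {n b′} (rs : Vec (Vec Bool (suc b′)) n) → StartsFull rs →
  rowIndexSum rs ≡ rowIndexSum (V.map dropFirst rs) + sumUpTo n (λ i → i)
rowIndexSum-dropFirst []       full = refl
rowIndexSum-dropFirst {suc n} (r ∷ rs) full =
  trans (cong₂ _+_ (rowIndexSum-dropFirst rs full′) (card-dropFirst rs full′))
        (regroup (rowIndexSum (V.map dropFirst rs)) (sumUpTo n (λ i → i)) (card (V.map dropFirst rs)) n)
  where
  full′ : StartsFull rs
  full′ k k<n = full (suc k) (s≤s k<n)
  regroup : ∀ r t c n → r + t + (c + n) ≡ r + c + (t + n)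
  regroup = solve-∀

colIndexSum-dropFirst : ∀ {n b′} (rs : Vec (Vec Bool (suc b′)) n) →
  colIndexSum rs ≡ colIndexSum (V.map dropFirst rs) + card (V.map dropFirst rs)
colIndexSum-dropFirst []            = refl
colIndexSum-dropFirst ((x ∷ r) ∷ rs) = begin
  indexSum r + countRow r + colIndexSum rs                    ≡⟨ cong₂ (λ i c → i + c + colIndexSum rs) (indexSum-∷ʳ-false r) (countRow-∷ʳ-false r) ⟨
  indexSum r′ + countRow r′ + colIndexSum rs                  ≡⟨ cong (indexSum r′ + countRow r′ +_) (colIndexSum-dropFirst rs) ⟩
  indexSum r′ + countRow r′ + (colIndexSum rs′ + card rs′)    ≡⟨ regroup (indexSum r′) (countRow r′) (colIndexSum rs′) (card rs′) ⟩
  indexSum r′ + colIndexSum rs′ + (countRow r′ + card rs′)    ∎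
  where
  r′ = r ∷ʳ false
  rs′ = V.map dropFirst rs
  regroup : ∀ i c s d → i + c + (s + d) ≡ i + s + (c + d)
  regroup = solve-∀

card-pushRow : ∀ {n b} (rs : Vec (Vec Bool b) n) new → countRow (leavingRow rs new) ≡ 0 →
  card (pushRow new rs) ≡ countRow new + card rs
card-pushRow []       new empty = sym (trans (+-comm (countRow new) 0) empty)
card-pushRow (r ∷ rs) new empty = cong (countRow new +_) (card-pushRow rs r empty)

rowIndexSum-pushRow : ∀ {n b} (rs : Vec (Vec Bool b) n) new → countRow (leavingRow rs new) ≡ 0 →
  rowIndexSum (pushRow new rs) ≡ rowIndexSum rs + card rs
rowIndexSum-pushRow []       new empty = refl
rowIndexSum-pushRow (r ∷ rs) new empty =
  cong₂ _+_ (rowIndexSum-pushRow rs r empty) (card-pushRow rs r empty)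

colIndexSum-pushRow : ∀ {n b} (rs : Vec (Vec Bool b) n) new → countRow (leavingRow rs new) ≡ 0 →
  colIndexSum (pushRow new rs) ≡ indexSum new + colIndexSum rs
colIndexSum-pushRow []       new empty = sym (trans (+-comm (indexSum new) 0) (indexSum-empty new empty))
colIndexSum-pushRow (r ∷ rs) new empty = cong (indexSum new +_) (colIndexSum-pushRow rs r empty)

gauss : ∀ n → 2 * sumUpTo n (λ i → i) + n ≡ n * n
gauss zero    = refl
gauss (suc n) = begin
  2 * (t + n) + suc n       ≡⟨ regroup t n ⟩
  (2 * t + n) + suc (2 * n) ≡⟨ cong (_+ suc (2 * n)) (gauss n) ⟩
  n * n + suc (2 * n)       ≡⟨ square n ⟩
  suc n * suc n             ∎
  where
  t = sumUpTo n (λ i → i)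
  regroup : ∀ t n → 2 * (t + n) + suc n ≡ (2 * t + n) + suc (2 * n)
  regroup = solve-∀
  square : ∀ n → n * n + suc (2 * n) ≡ suc n * suc n
  square = solve-∀

-- Promotion changes them so that
--   kPotential ∂I + ab + ℓPotential I = kPotential I + 2·#I + ℓPotential ∂I,
-- i.e. 2·#I − ab is the increment of kPotential − ℓPotential along promotion.
kPotential : ∀ {a b} → Subset a b → ℕ
kPotential {b = b} J = 2 * rowIndexSum J + b * card J

ℓPotential : ∀ {a b} → Subset a b → ℕ
ℓPotential {a = a} J = 2 * colIndexSum J + suc a * card J

-- The identity for a shift in ℓ, in terms of the statistics of ∂I
-- (R′, C′, L′ = row-index sum, size, column-index sum; t = Σ_{i<a} i).
ℓ-shift-identity : ∀ a b {R C L R′ C′ L′ t} → 2 * t + a ≡ a * a →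
  C ≡ C′ + a → R ≡ R′ + t → L ≡ L′ + C′ →
  (2 * R′ + b * C′) + a * b + (2 * L + suc a * C) ≡ (2 * R + b * C) + 2 * C + (2 * L′ + suc a * C′)
ℓ-shift-identity a b {R′ = R′} {C′} {L′} {t} gauss-a refl refl refl = begin
  (2 * R′ + b * C′) + a * b + (2 * (L′ + C′) + suc a * (C′ + a)) ≡⟨ lhs a b R′ C′ L′ ⟩
  Z + a * a                                                     ≡⟨ cong (Z +_) gauss-a ⟨
  Z + (2 * t + a)                                               ≡⟨ rhs a b R′ C′ L′ t ⟩
  (2 * (R′ + t) + b * (C′ + a)) + 2 * (C′ + a) + (2 * L′ + suc a * C′) ∎
  where
  Z = 2 * R′ + b * C′ + a * b + 2 * L′ + 2 * C′ + suc a * C′ + a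
  lhs : ∀ a b R′ C′ L′ → (2 * R′ + b * C′) + a * b + (2 * (L′ + C′) + suc a * (C′ + a))
                       ≡ (2 * R′ + b * C′ + a * b + 2 * L′ + 2 * C′ + suc a * C′ + a) + a * a
  lhs = solve-∀
  rhs : ∀ a b R′ C′ L′ t → (2 * R′ + b * C′ + a * b + 2 * L′ + 2 * C′ + suc a * C′ + a) + (2 * t + a)
                         ≡ (2 * (R′ + t) + b * (C′ + a)) + 2 * (C′ + a) + (2 * L′ + suc a * C′)
  rhs = solve-∀

-- The identity for a shift in k, in terms of the statistics of I
-- (t = Σ_{i<b} i).
k-shift-identity : ∀ a b {R C L R′ C′ L′ t} → 2 * t + b ≡ b * b →
  C′ ≡ b + C → R′ ≡ R + C → L′ ≡ t + L →
  (2 * R′ + b * C′) + a * b + (2 * L + suc a * C) ≡ (2 * R + b * C) + 2 * C + (2 * L′ + suc a * C′)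
k-shift-identity a b {R} {C} {L} {t = t} gauss-b refl refl refl = begin
  (2 * (R + C) + b * (b + C)) + a * b + (2 * L + suc a * C) ≡⟨ lhs a b R C L ⟩
  Z + b * b                                                 ≡⟨ cong (Z +_) gauss-b ⟨
  Z + (2 * t + b)                                           ≡⟨ rhs a b R C L t ⟩
  (2 * R + b * C) + 2 * C + (2 * (t + L) + suc a * (b + C)) ∎
  where
  Z = 2 * R + 2 * C + b * C + a * b + 2 * L + suc a * C
  lhs : ∀ a b R C L → (2 * (R + C) + b * (b + C)) + a * b + (2 * L + suc a * C)
                    ≡ (2 * R + 2 * C + b * C + a * b + 2 * L + suc a * C) + b * b
  lhs = solve-∀
  rhs : ∀ a b R C L t → (2 * R + 2 * C + b * C + a * b + 2 * L + suc a * C) + (2 * t + b)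
                      ≡ (2 * R + b * C) + 2 * C + (2 * (t + L) + suc a * (b + C))
  rhs = solve-∀

leavingRow-rowAt : ∀ {n b} (rs : Vec (Vec Bool b) (suc n)) new ℓ →
  rowAt (leavingRow rs new) ℓ ≡ memAt rs n ℓ
leavingRow-rowAt (r ∷ V.[])     new ℓ = refl
leavingRow-rowAt (r ∷ r′ ∷ rs) new ℓ = leavingRow-rowAt (r′ ∷ rs) r ℓ

potential-step : ∀ {a′ b′} (I : Subset (suc a′) (suc b′)) → IsIdeal I →
  let J = shifted (memAt I a′ 0) I in
  kPotential J + suc a′ * suc b′ + ℓPotential I ≡ kPotential I + 2 * card I + ℓPotential J
potential-step {a′} {b′} I ideal = by-corner (memAt I a′ 0) refl
  where
  down = ideal⇒downset I ideal
  by-corner : ∀ B → memAt I a′ 0 ≡ B →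
    kPotential (shifted B I) + suc a′ * suc b′ + ℓPotential I ≡ kPotential I + 2 * card I + ℓPotential (shifted B I)
  -- the corner is present, so the whole column ℓ = 0 is present
  by-corner true corner =
    ℓ-shift-identity (suc a′) (suc b′) {R′ = rowIndexSum (V.map dropFirst I)} (gauss (suc a′))
      (card-dropFirst I full) (rowIndexSum-dropFirst I full) (colIndexSum-dropFirst I)
    where
    full : StartsFull I
    full k k<a = down a′ 0 k 0 (≤-pred k<a) ≤-refl corner
  -- the corner is absent, so the whole row k = a′ is absent
  by-corner false corner =
    k-shift-identity (suc a′) (suc b′) {L = colIndexSum I} (gauss (suc b′))
      (trans (card-pushRow I ones empty) (cong (_+ card I) (countRow-full (suc b′))))
      (rowIndexSum-pushRow I ones empty)
      (trans (colIndexSum-pushRow I ones empty) (cong (_+ colIndexSum I) (indexSum-full (suc b′))))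
    where
    ones = V.replicate (suc b′) true
    last-row-absent : ∀ ℓ → memAt I a′ ℓ ≡ false
    last-row-absent ℓ = ¬-not λ x∈ → contradiction (trans (sym (down a′ ℓ a′ 0 ≤-refl z≤n x∈)) corner) λ ()
    empty : countRow (leavingRow I ones) ≡ 0
    empty = countRow-empty (leavingRow I ones) (λ ℓ → trans (leavingRow-rowAt I ones ℓ) (last-row-absent ℓ))

telescope-partial : ∀ (Φ Ψ g : ℕ → ℕ) K → (∀ i → Φ (suc i) + K + Ψ i ≡ Φ i + g i + Ψ (suc i)) →
  ∀ m → Φ m + m * K + Ψ 0 ≡ Φ 0 + sumUpTo m g + Ψ m
telescope-partial Φ Ψ g K step zero    = refl
telescope-partial Φ Ψ g K step (suc m) = +-cancelʳ-≡ (Φ m) _ _ (begin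
  Φ (suc m) + (K + m * K) + Ψ 0 + Φ m        ≡⟨ regroup₁ (Φ (suc m)) K (m * K) (Ψ 0) (Φ m) ⟩
  (Φ (suc m) + K) + (Φ m + m * K + Ψ 0)      ≡⟨ cong ((Φ (suc m) + K) +_) (telescope-partial Φ Ψ g K step m) ⟩
  (Φ (suc m) + K) + (Φ 0 + G + Ψ m)          ≡⟨ regroup₂ (Φ (suc m)) K (Φ 0) G (Ψ m) ⟩
  (Φ (suc m) + K + Ψ m) + (Φ 0 + G)          ≡⟨ cong (_+ (Φ 0 + G)) (step m) ⟩
  (Φ m + g m + Ψ (suc m)) + (Φ 0 + G)        ≡⟨ regroup₃ (Φ m) (g m) (Ψ (suc m)) (Φ 0) G ⟩
  Φ 0 + (G + g m) + Ψ (suc m) + Φ m          ∎)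
  where
  G = sumUpTo m g
  regroup₁ : ∀ p k mk q r → p + (k + mk) + q + r ≡ (p + k) + (r + mk + q)
  regroup₁ = solve-∀
  regroup₂ : ∀ p k r s q → (p + k) + (r + s + q) ≡ (p + k + q) + (r + s)
  regroup₂ = solve-∀
  regroup₃ : ∀ r x q p s → (r + x + q) + (p + s) ≡ p + (s + x) + q + r
  regroup₃ = solve-∀

telescope : ∀ (Φ Ψ g : ℕ → ℕ) K n → (∀ i → Φ (suc i) + K + Ψ i ≡ Φ i + g i + Ψ (suc i)) →
  Φ n ≡ Φ 0 → Ψ n ≡ Ψ 0 → n * K ≡ sumUpTo n g
telescope Φ Ψ g K n step Φ-period Ψ-period =
  +-cancelˡ-≡ (Φ 0) _ _ (+-cancelʳ-≡ (Ψ 0) _ _ (begin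
    Φ 0 + n * K + Ψ 0        ≡⟨ cong (λ x → x + n * K + Ψ 0) Φ-period ⟨
    Φ n + n * K + Ψ 0        ≡⟨ telescope-partial Φ Ψ g K step n ⟩
    Φ 0 + sumUpTo n g + Ψ n  ≡⟨ cong (Φ 0 + sumUpTo n g +_) Ψ-period ⟩
    Φ 0 + sumUpTo n g + Ψ 0  ∎))

sumUpTo-scale : ∀ n c (f : ℕ → ℕ) → sumUpTo n (λ i → c * f i) ≡ c * sumUpTo n f
sumUpTo-scale zero    c f = sym (*-zeroʳ c)
sumUpTo-scale (suc n) c f = trans (cong (_+ c * f n) (sumUpTo-scale n c f)) (sym (*-distribˡ-+ c _ _))

toggles-preserve-ideal : ∀ {a b} (s : List (Elt a b)) J → IsIdeal J →
  IsIdeal (foldl (λ J x → toggle x J) J s)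
toggles-preserve-ideal []      J ideal = ideal
toggles-preserve-ideal (x ∷ s) J ideal = toggles-preserve-ideal s (toggle x J) (toggle-preserves-ideal x J ideal)

orbit-ideal : ∀ {a b} (e : List (Elt a b)) I → IsIdeal I → ∀ i → IsIdeal (iter (promotion e) i I)
orbit-ideal e I ideal zero    = ideal
orbit-ideal e I ideal (suc i) = toggles-preserve-ideal e _ (orbit-ideal e I ideal i)

promotion-shifted : ∀ {a′ b′} (e : List (Elt (suc a′) (suc b′))) → IsDiagEnumeration e →
  (I : Subset (suc a′) (suc b′)) → IsIdeal I → promotion e I ≡ shifted (memAt I a′ 0) I
promotion-shifted {a′} {b′} e enum I ideal = subset-ext _ _ λ k ℓ →
  trans (Sweep.promotion-closed-form a′ (suc b′) I ideal e enum k ℓ)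
        (sym (memAt-shifted (memAt I a′ 0) I _ _ (FP.toℕ<n k) (FP.toℕ<n ℓ)))

theorem19 : (a b : ℕ) → 1 ≤ a → 1 ≤ b →
    (e : List (Elt a b)) → IsDiagEnumeration e →
    (I : Subset a b) → IsIdeal I →
    (n : ℕ) → IsOrbitSize (promotion e) I n →
    2 * sumUpTo n (λ i → card (iter (promotion e) i I)) ≡ n * (a * b)
theorem19 (suc a′) (suc b′) (s≤s z≤n) (s≤s z≤n) e enum I ideal n (_ , returns , _) =
  sym (trans (telescope (kPotential ∘ orbit) (ℓPotential ∘ orbit) (λ i → 2 * card (orbit i))
                        (suc a′ * suc b′) n step
                        (cong kPotential returns) (cong ℓPotential returns))
             (sumUpTo-scale n 2 (card ∘ orbit)))
  where
  -- ∂ⁱ I, an ideal for every i; only ∂ⁿ I = I is used from the orbit size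
  orbit : ℕ → Subset (suc a′) (suc b′)
  orbit i = iter (promotion e) i I
  step : ∀ i → kPotential (orbit (suc i)) + suc a′ * suc b′ + ℓPotential (orbit i)
             ≡ kPotential (orbit i) + 2 * card (orbit i) + ℓPotential (orbit (suc i))
  step i = subst (λ J → kPotential J + suc a′ * suc b′ + ℓPotential (orbit i)
                      ≡ kPotential (orbit i) + 2 * card (orbit i) + ℓPotential J)
             (sym (promotion-shifted e enum (orbit i) (orbit-ideal e I ideal i)))
             (potential-step (orbit i) (orbit-ideal e I ideal i))
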